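{- Let $A$ and $A'$ be unimodular square matrices (of sizes $n\times n$ and $n'\times n'$) with non-negative integer entries, each having some power with strictly positive entries, and let $G_A$, $G_{A'}$ be the associated stationary $AF$-algebras. Let $p(x)\in\mathbb{Z}[x]$ be any polynomial with $p(0)=\pm 1$. If $G_A$ and $G_{A'}$ are strongly stably isomorphic, then the abelian groups $Ab_{p(x)}(G_A)=\mathbb{Z}^n/p(A)\mathbb{Z}^n$ and $Ab_{p(x)}(G_{A'})=\mathbb{Z}^{n'}/p(A')\mathbb{Z}^{n'}$ are isomorphic. That is, $Ab_{p(x)}(G_A)$ is an invariant of the strong stable isomorphism class of $G_A$.
   Context: A matrix is unimodular if its determinant is $\pm1$. For such an $A$ (size $n\times n$), $G_A$ denotes the $AF$-algebra given by the stationary (periodic) Bratteli diagram whose incidence matrix at every level is $A$. Its dimension group $(G_A,G_A^+)$ is the ordered group obtained as the direct limit $\mathbb{Z}^n\xrightarrow{A}\mathbb{Z}^n\xrightarrow{A}\mathbb{Z}^n\xrightarrow{A}\cdots$ with the positive cone coming from $\mathbb{Z}^n_{\ge 0}$. The shift automorphism $\sigma_A$ is the order-automorphism of $(G_A,G_A^+)$ induced by $A$ (equivalently, multiplication by the Perron–Frobenius eigenvalue $\lambda_A$ when $G_A$ is realized inside $\mathbb{R}$ via the Perron–Frobenius eigenvector). Two $C^*$-algebras $B,B'$ are stably isomorphic if $B\otimes\mathcal{K}\cong B'\otimes\mathcal{K}$, $\mathcal{K}$ the compact operators on a separable Hilbert space; for $AF$-algebras this is equivalent to order-isomorphism of their dimension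 groups. $G_A$ and $G_{A'}$ are strongly stably isomorphic if there is an order-isomorphism $\theta:(G_{A'},G_{A'}^+)\to(G_A,G_A^+)$ of dimension groups with $\sigma_A\circ\theta=\theta\circ\sigma_{A'}$ (conjugate shift automorphisms). -}

module Defs where

open import Data.Nat as ℕ using (ℕ; zero; suc)
open import Data.Integer as ℤ using (ℤ; +_; -_; 0ℤ; 1ℤ; -1ℤ)
open import Data.Fin using (Fin; zero; suc; punchIn)
open import Data.List using (List; []; _∷_)
open import Data.Product using (Σ; ∃; _×_; _,_)
open import Data.Sum using (_⊎_)
open import Relation.Binary.PropositionalEquality using (_≡_)
open import Relation.Nullary using (Dec; yes; no)
open import Data.Fin using (_≟_)

Vecℤ : ℕ → Set
Vecℤ n = Fin n → ℤ

Matℤ : ℕ → Set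
Matℤ n = Fin n → Fin n → ℤ

Matℕ : ℕ → Set
Matℕ n = Fin n → Fin n → ℕ

toℤ : ∀ {n} → Matℕ n → Matℤ n
toℤ A i j = + (A i j)

∑ : ∀ {n} → (Fin n → ℤ) → ℤ
∑ {zero}  f = 0ℤ
∑ {suc n} f = f zero ℤ.+ ∑ (λ i → f (suc i))

_·_ : ∀ {n} → Matℤ n → Matℤ n → Matℤ n
(M · N) i k = ∑ (λ j → M i j ℤ.* N j k)

idM : ∀ {n} → Matℤ n
idM i j with i ≟ j
... | yes _ = 1ℤ
... | no  _ = 0ℤ

_^M_ : ∀ {n} → Matℤ n → ℕ → Matℤ n
M ^M zero  = idM
M ^M suc k = M · (M ^M k)

_▷_ : ∀ {n} → Matℤ n → Vecℤ n → Vecℤ n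
(M ▷ v) i = ∑ (λ j → M i j ℤ.* v j)

_⊞_ : ∀ {n} → Vecℤ n → Vecℤ n → Vecℤ n
(v ⊞ w) i = v i ℤ.+ w i

sgn : ∀ {n} → Fin n → ℤ
sgn zero    = 1ℤ
sgn (suc j) = - sgn j

det : ∀ {n} → Matℤ n → ℤ
det {zero}  M = 1ℤ
det {suc n} M =
  ∑ (λ j → sgn j ℤ.* (M zero j ℤ.* det (λ i k → M (suc i) (punchIn j k))))

Unimodular : ∀ {n} → Matℤ n → Set
Unimodular M = det M ≡ 1ℤ ⊎ det M ≡ -1ℤ

Primitive : ∀ {n} → Matℤ n → Set
Primitive M = ∃ λ k → ∀ i j → 0ℤ ℤ.< (M ^M suc k) i j

-- Integer polynomials: coefficient lists, constant term first

Poly : Set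
Poly = List ℤ

const : Poly → ℤ
const []      = 0ℤ
const (c ∷ _) = c

scal : ∀ {n} → ℤ → Matℤ n
scal c i j = c ℤ.* idM i j

_⊕M_ : ∀ {n} → Matℤ n → Matℤ n → Matℤ n
(M ⊕M N) i j = M i j ℤ.+ N i j

evalM : ∀ {n} → Poly → Matℤ n → Matℤ n
evalM []       M = λ _ _ → 0ℤ
evalM (c ∷ cs) M = scal c ⊕M (M · evalM cs M)

-- Ab_p(G_A) = ℤⁿ / p(A)ℤⁿ, presented as ℤⁿ with the congruence
-- v ~ w  iff  v - w ∈ p(A)ℤⁿ

_~[_]_ : ∀ {n} → Vecℤ n → Matℤ n → Vecℤ n → Set
v ~[ P ] w = ∃ λ u → ∀ i → v i ℤ.- w i ≡ (P ▷ u) i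

-- isomorphism of abelian groups ℤⁿ/Pℤⁿ ≅ ℤⁿ'/P'ℤⁿ' : a map of
-- representatives that is well defined, additive, injective and surjective
-- on the quotients
CokerIso : ∀ {n n'} → Matℤ n → Matℤ n' → Set
CokerIso {n} {n'} P P' =
  Σ (Vecℤ n → Vecℤ n') λ f →
    (∀ v w → v ~[ P ] w → f v ~[ P' ] f w) ×
    (∀ v w → f (v ⊞ w) ~[ P' ] (f v ⊞ f w)) ×
    (∀ v w → f v ~[ P' ] f w → v ~[ P ] w) ×
    (∀ y → ∃ λ v → f v ~[ P' ] y)

-- Dimension group of the stationary Bratteli diagram with matrix A:
-- direct limit ℤⁿ →A ℤⁿ →A ⋯ .  An element is a pair (v , i) meaning
-- the image of v ∈ ℤⁿ from the i-th copy.

DL : ℕ → Set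
DL n = Vecℤ n × ℕ

-- (v , i) and (w , j) are identified iff they agree at some later level
_≈[_]_ : ∀ {n} → DL n → Matℤ n → DL n → Set
(v , i) ≈[ A ] (w , j) =
  ∃ λ k → ∀ r → ((A ^M (j ℕ.+ k)) ▷ v) r ≡ ((A ^M (i ℕ.+ k)) ▷ w) r

-- group addition: push both to level i + j
addDL : ∀ {n} → Matℤ n → DL n → DL n → DL n
addDL A (v , i) (w , j) = (((A ^M j) ▷ v) ⊞ ((A ^M i) ▷ w)) , (i ℕ.+ j)

-- positive cone: image of ℤⁿ_{≥0} from some level
PosDL : ∀ {n} → Matℤ n → DL n → Set
PosDL A (v , i) = ∃ λ k → ∀ r → 0ℤ ℤ.≤ ((A ^M k) ▷ v) r

shift : ∀ {n} → Matℤ n → DL n → DL n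
shift A (v , i) = (A ▷ v) , i

-- G_A and G_A' strongly stably isomorphic: an order isomorphism
-- θ : (G_A', G_A'⁺) → (G_A, G_A⁺) with σ_A ∘ θ = θ ∘ σ_A'
StronglyStablyIso : ∀ {n n'} → Matℤ n → Matℤ n' → Set
StronglyStablyIso {n} {n'} A A' =
  Σ (DL n' → DL n) λ θ →
    (∀ x y → x ≈[ A' ] y → θ x ≈[ A ] θ y) ×
    (∀ x y → θ (addDL A' x y) ≈[ A ] addDL A (θ x) (θ y)) ×
    (∀ x y → θ x ≈[ A ] θ y → x ≈[ A' ] y) ×
    (∀ z → ∃ λ x → θ x ≈[ A ] z) ×
    (∀ x → PosDL A' x → PosDL A (θ x)) ×
    (∀ x → PosDL A (θ x) → PosDL A' x) ×
    (∀ x → shift A (θ x) ≈[ A ] θ (shift A' x))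

-- Write p(x) = c + x·q(x) with c = ±1.  Modulo p(A) the matrix A becomes
-- invertible with inverse Ā = -c·q(A), so (v at level i) ↦ Ā^i v is a
-- well-defined homomorphism low : G_A → ℤⁿ/p(A)ℤⁿ turning the shift into A.
-- For a shift-commuting group isomorphism θ : G_A' → G_A, the map
-- v ↦ low (θ (v at level 0)) is additive and intertwines A' with A modulo
-- p(A); hence it is ℤ-linear, intertwines p(A') with p(A), and descends to a
-- homomorphism of cokernels.  The same construction for θ⁻¹ gives its inverse.
module Submission where

open import Defs
open import Data.Nat using (ℕ)
open import Data.Integer using (1ℤ; -1ℤ)
open import Data.Sum using (_⊎_)
open import Relation.Binary.PropositionalEquality using (_≡_)

open import Data.Nat as ℕ using (zero; suc)
import Data.Nat.Properties as ℕP
import Data.Nat.Tactic.RingSolver as ℕ-Solver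
open import Data.Integer as ℤ using (ℤ; -[1+_]; -_; 0ℤ; _+_; _*_; _-_)
import Data.Integer.Properties as ℤP
open import Data.Integer.Tactic.RingSolver using (solve-∀)
open import Data.Fin using (Fin; zero; suc)
open import Data.Fin.Properties using (_≟_)
open import Data.List using ([]; _∷_)
open import Data.Product using (_,_; proj₁; proj₂)
open import Data.Sum using (inj₁; inj₂)
open import Function using (_∘_)
open import Relation.Binary.Bundles using (Setoid)
open import Relation.Binary.PropositionalEquality
  using (refl; sym; trans; cong; cong₂; _≗_; _→-setoid_; module ≡-Reasoning)
import Relation.Binary.Reasoning.Setoid as SetoidReasoning
open import Relation.Nullary using (yes; no)

module ≗-Reasoning {n : ℕ} = SetoidReasoning (Fin n →-setoid ℤ)

≗-sym : ∀ {n} {v w : Vecℤ n} → v ≗ w → w ≗ v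
≗-sym p i = sym (p i)

≗-trans : ∀ {n} {u v w : Vecℤ n} → u ≗ v → v ≗ w → u ≗ w
≗-trans p q i = trans (p i) (q i)

∑-cong : ∀ {n} {f g : Fin n → ℤ} → (∀ i → f i ≡ g i) → ∑ f ≡ ∑ g
∑-cong {zero}  h = refl
∑-cong {suc n} h = cong₂ _+_ (h zero) (∑-cong (h ∘ suc))

∑-zero : ∀ {n} (f : Fin n → ℤ) → (∀ i → f i ≡ 0ℤ) → ∑ f ≡ 0ℤ
∑-zero {zero}  f h = refl
∑-zero {suc n} f h = cong₂ _+_ (h zero) (∑-zero (f ∘ suc) (h ∘ suc))

∑-+ : ∀ {n} (f g : Fin n → ℤ) → ∑ (λ i → f i + g i) ≡ ∑ f + ∑ g
∑-+ {zero}  f g = refl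
∑-+ {suc n} f g =
  trans (cong ((f zero + g zero) +_) (∑-+ (f ∘ suc) (g ∘ suc)))
        (interchange (f zero) (g zero) (∑ (f ∘ suc)) (∑ (g ∘ suc)))
  where
  interchange : ∀ a b c d → (a + b) + (c + d) ≡ (a + c) + (b + d)
  interchange = solve-∀

∑-* : ∀ {n} (c : ℤ) (f : Fin n → ℤ) → ∑ (λ i → c * f i) ≡ c * ∑ f
∑-* {zero}  c f = sym (ℤP.*-zeroʳ c)
∑-* {suc n} c f =
  trans (cong (c * f zero +_) (∑-* c (f ∘ suc))) (sym (ℤP.*-distribˡ-+ c (f zero) _))

∑-swap : ∀ {m n} (f : Fin m → Fin n → ℤ) →
         ∑ (λ i → ∑ (λ j → f i j)) ≡ ∑ (λ j → ∑ (λ i → f i j))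
∑-swap {zero} {n} f = sym (∑-zero {n} _ (λ _ → refl))
∑-swap {suc m} f = trans (cong (∑ (f zero) +_) (∑-swap (f ∘ suc))) (sym (∑-+ (f zero) _))

0v : ∀ {n} → Vecℤ n
0v _ = 0ℤ

infixr 7 _⊙_
_⊙_ : ∀ {n} → ℤ → Vecℤ n → Vecℤ n
(d ⊙ v) i = d * v i

⊞-cong : ∀ {n} {v v' w w' : Vecℤ n} → v ≗ v' → w ≗ w' → v ⊞ w ≗ v' ⊞ w'
⊞-cong p q i = cong₂ _+_ (p i) (q i)

▷-cong : ∀ {n} (M : Matℤ n) {v w : Vecℤ n} → v ≗ w → M ▷ v ≗ M ▷ w
▷-cong M h i = ∑-cong (λ j → cong (M i j *_) (h j))

▷-⊞ : ∀ {n} (M : Matℤ n) v w → M ▷ (v ⊞ w) ≗ (M ▷ v) ⊞ (M ▷ w)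
▷-⊞ M v w i =
  trans (∑-cong (λ j → ℤP.*-distribˡ-+ (M i j) (v j) (w j))) (∑-+ (λ j → M i j * v j) (λ j → M i j * w j))

▷-⊙ : ∀ {n} (M : Matℤ n) d v → M ▷ (d ⊙ v) ≗ d ⊙ (M ▷ v)
▷-⊙ M d v i = trans (∑-cong (λ j → swapFactor (M i j) d (v j))) (∑-* d (λ j → M i j * v j))
  where
  swapFactor : ∀ a d x → a * (d * x) ≡ d * (a * x)
  swapFactor = solve-∀

▷-0v : ∀ {n} (M : Matℤ n) → M ▷ 0v ≗ 0v
▷-0v M i = ∑-zero _ (λ j → ℤP.*-zeroʳ (M i j))

▷-· : ∀ {n} (M N : Matℤ n) v → (M · N) ▷ v ≗ M ▷ (N ▷ v)
▷-· M N v i = begin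
  ∑ (λ j → ∑ (λ l → M i l * N l j) * v j)   ≡⟨ ∑-cong (λ j → ∑-*ʳ (v j) (λ l → M i l * N l j)) ⟩
  ∑ (λ j → ∑ (λ l → M i l * N l j * v j))   ≡⟨ ∑-swap (λ j l → M i l * N l j * v j) ⟩
  ∑ (λ l → ∑ (λ j → M i l * N l j * v j))   ≡⟨ ∑-cong (λ l → trans (∑-cong (λ j → ℤP.*-assoc (M i l) (N l j) (v j))) (∑-* (M i l) (λ j → N l j * v j))) ⟩
  ∑ (λ l → M i l * (N ▷ v) l)               ∎
  where
  open ≡-Reasoning
  ∑-*ʳ : ∀ {n} (c : ℤ) (f : Fin n → ℤ) → ∑ f * c ≡ ∑ (λ i → f i * c)
  ∑-*ʳ c f = trans (ℤP.*-comm _ c) (trans (sym (∑-* c f)) (∑-cong (λ i → ℤP.*-comm c (f i))))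

idM-▷ : ∀ {n} (v : Vecℤ n) → idM ▷ v ≗ v
idM-▷ {suc n} v zero =
  trans (cong₂ _+_ (ℤP.*-identityˡ (v zero)) (∑-zero _ (λ j → ℤP.*-zeroˡ (v (suc j)))))
        (ℤP.+-identityʳ _)
idM-▷ {suc n} v (suc i) =
  trans (cong₂ _+_ (ℤP.*-zeroˡ (v zero))
          (trans (∑-cong (λ j → cong (_* v (suc j)) (idM-suc i j))) (idM-▷ (v ∘ suc) i)))
        (ℤP.+-identityˡ _)
  where
  idM-suc : ∀ {n} (i j : Fin n) → idM {suc n} (suc i) (suc j) ≡ idM i j
  idM-suc i j with i ≟ j
  ... | yes _ = refl
  ... | no  _ = refl

⊕M-▷ : ∀ {n} (M N : Matℤ n) v → (M ⊕M N) ▷ v ≗ (M ▷ v) ⊞ (N ▷ v)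
⊕M-▷ M N v i =
  trans (∑-cong (λ j → ℤP.*-distribʳ-+ (v j) (M i j) (N i j))) (∑-+ (λ j → M i j * v j) (λ j → N i j * v j))

scal-▷ : ∀ {n} c (v : Vecℤ n) → scal c ▷ v ≗ c ⊙ v
scal-▷ c v i =
  trans (∑-cong (λ j → ℤP.*-assoc c (idM i j) (v j))) (trans (∑-* c (λ j → idM i j * v j)) (cong (c *_) (idM-▷ v i)))

evalM-[] : ∀ {n} (M : Matℤ n) v → evalM [] M ▷ v ≗ 0v
evalM-[] M v i = ∑-zero _ (λ j → ℤP.*-zeroˡ (v j))

evalM-∷ : ∀ {n} (M : Matℤ n) d q v →
          evalM (d ∷ q) M ▷ v ≗ (d ⊙ v) ⊞ (M ▷ (evalM q M ▷ v))
evalM-∷ M d q v i =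
  trans (⊕M-▷ (scal d) (M · evalM q M) v i) (cong₂ _+_ (scal-▷ d v i) (▷-· M (evalM q M) v i))

Commute : ∀ {n} → Matℤ n → Matℤ n → Set
Commute M N = ∀ v → M ▷ (N ▷ v) ≗ N ▷ (M ▷ v)

evalM-comm : ∀ {n} (M : Matℤ n) q → Commute (evalM q M) M
evalM-comm M [] v = begin
  evalM [] M ▷ (M ▷ v)   ≈⟨ evalM-[] M (M ▷ v) ⟩
  0v                     ≈⟨ ▷-0v M ⟨
  M ▷ 0v                 ≈⟨ ▷-cong M (evalM-[] M v) ⟨
  M ▷ (evalM [] M ▷ v)   ∎
  where open ≗-Reasoning
evalM-comm M (d ∷ q) v = begin
  evalM (d ∷ q) M ▷ (M ▷ v)                        ≈⟨ evalM-∷ M d q (M ▷ v) ⟩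
  (d ⊙ (M ▷ v)) ⊞ (M ▷ (evalM q M ▷ (M ▷ v)))      ≈⟨ ⊞-cong (≗-sym (▷-⊙ M d v)) (▷-cong M (evalM-comm M q v)) ⟩
  (M ▷ (d ⊙ v)) ⊞ (M ▷ (M ▷ (evalM q M ▷ v)))      ≈⟨ ▷-⊞ M (d ⊙ v) (M ▷ (evalM q M ▷ v)) ⟨
  M ▷ ((d ⊙ v) ⊞ (M ▷ (evalM q M ▷ v)))            ≈⟨ ▷-cong M (evalM-∷ M d q v) ⟨
  M ▷ (evalM (d ∷ q) M ▷ v)                        ∎
  where open ≗-Reasoning

pow-+ : ∀ {n} (M : Matℤ n) a b v → (M ^M (a ℕ.+ b)) ▷ v ≗ (M ^M a) ▷ ((M ^M b) ▷ v)
pow-+ M zero    b v = ≗-sym (idM-▷ ((M ^M b) ▷ v))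
pow-+ M (suc a) b v = begin
  (M · (M ^M (a ℕ.+ b))) ▷ v          ≈⟨ ▷-· M (M ^M (a ℕ.+ b)) v ⟩
  M ▷ ((M ^M (a ℕ.+ b)) ▷ v)          ≈⟨ ▷-cong M (pow-+ M a b v) ⟩
  M ▷ ((M ^M a) ▷ ((M ^M b) ▷ v))     ≈⟨ ▷-· M (M ^M a) ((M ^M b) ▷ v) ⟨
  (M · (M ^M a)) ▷ ((M ^M b) ▷ v)     ∎
  where open ≗-Reasoning

pow-≡ : ∀ {n} (M : Matℤ n) v {a b} → a ≡ b → (M ^M a) ▷ v ≗ (M ^M b) ▷ v
pow-≡ M v refl i = refl

pow-comm : ∀ {n} (M N : Matℤ n) → Commute M N → ∀ a → Commute (M ^M a) N
pow-comm M N MN zero v = ≗-trans (idM-▷ (N ▷ v)) (▷-cong N (≗-sym (idM-▷ v)))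
pow-comm M N MN (suc a) v = begin
  (M · (M ^M a)) ▷ (N ▷ v)       ≈⟨ ▷-· M (M ^M a) (N ▷ v) ⟩
  M ▷ ((M ^M a) ▷ (N ▷ v))       ≈⟨ ▷-cong M (pow-comm M N MN a v) ⟩
  M ▷ (N ▷ ((M ^M a) ▷ v))       ≈⟨ MN ((M ^M a) ▷ v) ⟩
  N ▷ (M ▷ ((M ^M a) ▷ v))       ≈⟨ ▷-cong N (▷-· M (M ^M a) v) ⟨
  N ▷ ((M · (M ^M a)) ▷ v)       ∎
  where open ≗-Reasoning

pow-regroup : ∀ {n} (M : Matℤ n) v a b c d → a ℕ.+ b ≡ c ℕ.+ d →
              (M ^M a) ▷ ((M ^M b) ▷ v) ≗ (M ^M c) ▷ ((M ^M d) ▷ v)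
pow-regroup M v a b c d eq =
  ≗-trans (≗-sym (pow-+ M a b v)) (≗-trans (pow-≡ M v eq) (pow-+ M c d v))

pow-split : ∀ {n} (M : Matℤ n) v a b c → a ≡ b ℕ.+ c →
            (M ^M a) ▷ v ≗ (M ^M b) ▷ ((M ^M c) ▷ v)
pow-split M v a b c eq = ≗-trans (pow-≡ M v eq) (pow-+ M b c v)

-- The relation v ~[ P ] w wrapped in a record, so that Agda can infer v and
-- w from proofs
record Congruent {n : ℕ} (P : Matℤ n) (v w : Vecℤ n) : Set where
  constructor ⟨_⟩
  field inImage : v ~[ P ] w
open Congruent public

module Coker {n : ℕ} (P : Matℤ n) where

  infix 4 _~_
  _~_ : Vecℤ n → Vecℤ n → Set
  _~_ = Congruent P

  ~-≗ : ∀ {v w} → v ≗ w → v ~ w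
  ~-≗ {v} {w} h = ⟨ 0v , (λ i →
    trans (cong (_- w i) (h i)) (trans (ℤP.+-inverseʳ (w i)) (sym (▷-0v P i)))) ⟩

  ~-refl : ∀ {v} → v ~ v
  ~-refl = ~-≗ (λ _ → refl)

  ~-sym : ∀ {v w} → v ~ w → w ~ v
  ~-sym {v} {w} ⟨ u , h ⟩ = ⟨ -1ℤ ⊙ u , (λ i →
    trans (flipSign (v i) (w i)) (trans (cong (-1ℤ *_) (h i)) (sym (▷-⊙ P -1ℤ u i)))) ⟩
    where
    flipSign : ∀ a b → b - a ≡ -1ℤ * (a - b)
    flipSign = solve-∀

  ~-trans : ∀ {u v w} → u ~ v → v ~ w → u ~ w
  ~-trans {u} {v} {w} ⟨ x , g ⟩ ⟨ y , h ⟩ = ⟨ x ⊞ y , (λ i →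
    trans (sym (ℤP.+-minus-telescope (u i) (v i) (w i)))
          (trans (cong₂ _+_ (g i) (h i)) (sym (▷-⊞ P x y i)))) ⟩

  setoid : Setoid _ _
  setoid = record
    { Carrier       = Vecℤ n
    ; _≈_           = _~_
    ; isEquivalence = record { refl = ~-refl ; sym = ~-sym ; trans = ~-trans }
    }

  module ~-Reasoning = SetoidReasoning setoid

  ~-⊞ : ∀ {v v' w w'} → v ~ v' → w ~ w' → v ⊞ w ~ v' ⊞ w'
  ~-⊞ {v} {v'} {w} {w'} ⟨ x , g ⟩ ⟨ y , h ⟩ = ⟨ x ⊞ y , (λ i →
    trans (regroup (v i) (w i) (v' i) (w' i))
          (trans (cong₂ _+_ (g i) (h i)) (sym (▷-⊞ P x y i)))) ⟩
    where
    regroup : ∀ a b c d → (a + b) - (c + d) ≡ (a - c) + (b - d)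
    regroup = solve-∀

  ~-⊙ : ∀ d {v w} → v ~ w → d ⊙ v ~ d ⊙ w
  ~-⊙ d {v} {w} ⟨ x , h ⟩ = ⟨ d ⊙ x , (λ i →
    trans (factor d (v i) (w i)) (trans (cong (d *_) (h i)) (sym (▷-⊙ P d x i)))) ⟩
    where
    factor : ∀ d a b → d * a - d * b ≡ d * (a - b)
    factor = solve-∀

  ~-image : ∀ u → P ▷ u ~ 0v
  ~-image u = ⟨ u , (λ i → ℤP.+-identityʳ _) ⟩

  ~-▷ : ∀ (M : Matℤ n) → Commute M P → ∀ {v w} → v ~ w → M ▷ v ~ M ▷ w
  ~-▷ M MP {v} {w} ⟨ x , h ⟩ = ⟨ M ▷ x , (λ i →
    trans (▷-− i) (trans (▷-cong M h i) (MP x i))) ⟩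
    where
    -- M (v - w) = M v - M w, via v - w = v + (-1)·w
    ▷-− : ∀ i → (M ▷ v) i - (M ▷ w) i ≡ (M ▷ (λ j → v j - w j)) i
    ▷-− i = sym (trans (▷-cong M (λ j → cong (v j +_) (sym (ℤP.-1*i≡-i (w j)))) i)
                (trans (▷-⊞ M v (-1ℤ ⊙ w) i) (cong ((M ▷ v) i +_) (trans (▷-⊙ M -1ℤ w i) (ℤP.-1*i≡-i _)))))

  ~-pow : ∀ (M : Matℤ n) → (∀ {v w} → v ~ w → M ▷ v ~ M ▷ w) →
          ∀ a {v w} → v ~ w → (M ^M a) ▷ v ~ (M ^M a) ▷ w
  ~-pow M M-resp zero {v} {w} h = begin
    idM ▷ v        ≈⟨ ~-≗ (idM-▷ v) ⟩
    v              ≈⟨ h ⟩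
    w              ≈⟨ ~-≗ (idM-▷ w) ⟨
    idM ▷ w        ∎
    where open ~-Reasoning
  ~-pow M M-resp (suc a) {v} {w} h = begin
    (M · (M ^M a)) ▷ v     ≈⟨ ~-≗ (▷-· M (M ^M a) v) ⟩
    M ▷ ((M ^M a) ▷ v)     ≈⟨ M-resp (~-pow M M-resp a h) ⟩
    M ▷ ((M ^M a) ▷ w)     ≈⟨ ~-≗ (▷-· M (M ^M a) w) ⟨
    (M · (M ^M a)) ▷ w     ∎
    where open ~-Reasoning

  ~-cancel : ∀ {x} → x ~ x ⊞ x → x ~ 0v
  ~-cancel {x} h = begin
    x                           ≈⟨ ~-≗ (λ i → split (x i)) ⟩
    (x ⊞ x) ⊞ (-1ℤ ⊙ x)         ≈⟨ ~-⊞ (~-sym h) ~-refl ⟩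
    x ⊞ (-1ℤ ⊙ x)               ≈⟨ ~-≗ (λ i → cancel (x i)) ⟩
    0v                          ∎
    where
    open ~-Reasoning
    split : ∀ a → a ≡ (a + a) + -1ℤ * a
    split = solve-∀
    cancel : ∀ a → a + -1ℤ * a ≡ 0ℤ
    cancel = solve-∀

  ~-negate : ∀ {a b} → a ⊞ b ~ 0v → b ~ -1ℤ ⊙ a
  ~-negate {a} {b} h = begin
    b                           ≈⟨ ~-≗ (λ i → split (a i) (b i)) ⟩
    (a ⊞ b) ⊞ (-1ℤ ⊙ a)         ≈⟨ ~-⊞ h ~-refl ⟩
    0v ⊞ (-1ℤ ⊙ a)              ≈⟨ ~-≗ (λ i → ℤP.+-identityˡ _) ⟩
    -1ℤ ⊙ a                     ∎
    where
    open ~-Reasoning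
    split : ∀ a b → b ≡ (a + b) + -1ℤ * a
    split = solve-∀

module PolyCoker {n : ℕ} (M : Matℤ n) (p : Poly) where

  open Coker (evalM p M) public

  ~-M : ∀ {v w} → v ~ w → M ▷ v ~ M ▷ w
  ~-M = ~-▷ M (λ u → ≗-sym (evalM-comm M p u))

  ~-evalM : ∀ q {v w} → v ~ w → evalM q M ▷ v ~ evalM q M ▷ w
  ~-evalM [] {v} {w} h = ~-≗ (≗-trans (evalM-[] M v) (≗-sym (evalM-[] M w)))
  ~-evalM (d ∷ q) {v} {w} h = begin
    evalM (d ∷ q) M ▷ v                   ≈⟨ ~-≗ (evalM-∷ M d q v) ⟩
    (d ⊙ v) ⊞ (M ▷ (evalM q M ▷ v))       ≈⟨ ~-⊞ (~-⊙ d h) (~-M (~-evalM q h)) ⟩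
    (d ⊙ w) ⊞ (M ▷ (evalM q M ▷ w))       ≈⟨ ~-≗ (evalM-∷ M d q w) ⟨
    evalM (d ∷ q) M ▷ w                   ∎
    where open ~-Reasoning

-- When the constant term c of p is a unit (c² = 1), A becomes invertible on
-- ℤⁿ/p(A)ℤⁿ: writing p(x) = c + x·q(x), the matrix Ā = -c·q(A) satisfies
-- A·Ā ≡ Ā·A ≡ 1 modulo p(A), since p(A)·(c v) = v + c·A·q(A) v.
module UnitConstant {n : ℕ} (A : Matℤ n) (c : ℤ) (cs : Poly) (c²≡1 : c * c ≡ 1ℤ) where

  open PolyCoker A (c ∷ cs) public

  Ā : Matℤ n
  Ā = scal (- c) · evalM cs A

  Ā-▷ : ∀ v → Ā ▷ v ≗ (- c) ⊙ (evalM cs A ▷ v)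
  Ā-▷ v i = trans (▷-· (scal (- c)) (evalM cs A) v i) (scal-▷ (- c) (evalM cs A ▷ v) i)

  Ā-comm : Commute Ā A
  Ā-comm v = begin
    Ā ▷ (A ▷ v)                         ≈⟨ Ā-▷ (A ▷ v) ⟩
    (- c) ⊙ (evalM cs A ▷ (A ▷ v))      ≈⟨ (λ i → cong ((- c) *_) (evalM-comm A cs v i)) ⟩
    (- c) ⊙ (A ▷ (evalM cs A ▷ v))      ≈⟨ ▷-⊙ A (- c) (evalM cs A ▷ v) ⟨
    A ▷ ((- c) ⊙ (evalM cs A ▷ v))      ≈⟨ ▷-cong A (Ā-▷ v) ⟨
    A ▷ (Ā ▷ v)                         ∎
    where open ≗-Reasoning

  ~-Ā : ∀ {v w} → v ~ w → Ā ▷ v ~ Ā ▷ w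
  ~-Ā {v} {w} h = begin
    Ā ▷ v                               ≈⟨ ~-≗ (Ā-▷ v) ⟩
    (- c) ⊙ (evalM cs A ▷ v)            ≈⟨ ~-⊙ (- c) (~-evalM cs h) ⟩
    (- c) ⊙ (evalM cs A ▷ w)            ≈⟨ ~-≗ (Ā-▷ w) ⟨
    Ā ▷ w                               ∎
    where open ~-Reasoning

  Ā-A : ∀ v → Ā ▷ (A ▷ v) ~ v
  Ā-A v = ~-sym ⟨ c ⊙ v , (λ i → begin
    v i - (Ā ▷ (A ▷ v)) i                       ≡⟨ cong (λ z → v i - z) (Ā-comm v i) ⟩
    v i - (A ▷ (Ā ▷ v)) i                       ≡⟨ cong (λ z → v i - z) (▷-cong A (Ā-▷ v) i) ⟩
    v i - (A ▷ ((- c) ⊙ Q v)) i                 ≡⟨ cong (λ z → v i - z) (▷-⊙ A (- c) (Q v) i) ⟩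
    v i - (- c) * (A ▷ Q v) i                   ≡⟨ unitIdentity c (v i) ((A ▷ Q v) i) c²≡1 ⟩
    c * (c * v i) + c * (A ▷ Q v) i             ≡⟨ cong (λ z → c * (c * v i) + z) (▷-⊙ A c (Q v) i) ⟨
    c * (c * v i) + (A ▷ (c ⊙ Q v)) i           ≡⟨ cong (λ z → c * (c * v i) + z) (▷-cong A (▷-⊙ (evalM cs A) c v) i) ⟨
    c * (c * v i) + (A ▷ Q (c ⊙ v)) i           ≡⟨ evalM-∷ A c cs (c ⊙ v) i ⟨
    (evalM (c ∷ cs) A ▷ (c ⊙ v)) i              ∎) ⟩
    where
    open ≡-Reasoning
    Q : Vecℤ n → Vecℤ n
    Q u = evalM cs A ▷ u
    unitIdentity : ∀ c a b → c * c ≡ 1ℤ → a - (- c) * b ≡ c * (c * a) + c * b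
    unitIdentity c a b cc = begin
      a - (- c) * b            ≡⟨ expand c a b ⟩
      1ℤ * a + c * b           ≡⟨ cong (λ z → z * a + c * b) cc ⟨
      (c * c) * a + c * b      ≡⟨ cong (_+ c * b) (ℤP.*-assoc c c a) ⟩
      c * (c * a) + c * b      ∎
      where
      expand : ∀ c a b → a - (- c) * b ≡ 1ℤ * a + c * b
      expand = solve-∀

  Āᵃ-Aᵃ : ∀ a v → (Ā ^M a) ▷ ((A ^M a) ▷ v) ~ v
  Āᵃ-Aᵃ zero v = ~-≗ (≗-trans (idM-▷ (idM ▷ v)) (idM-▷ v))
  Āᵃ-Aᵃ (suc a) v = begin
    (Ā · (Ā ^M a)) ▷ ((A · (A ^M a)) ▷ v)    ≈⟨ ~-≗ (≗-trans (▷-· Ā (Ā ^M a) _)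
                                                   (▷-cong Ā (▷-cong (Ā ^M a) (▷-· A (A ^M a) v)))) ⟩
    Ā ▷ ((Ā ^M a) ▷ (A ▷ ((A ^M a) ▷ v)))    ≈⟨ ~-≗ (▷-cong Ā (pow-comm Ā A Ā-comm a ((A ^M a) ▷ v))) ⟩
    Ā ▷ (A ▷ ((Ā ^M a) ▷ ((A ^M a) ▷ v)))    ≈⟨ Ā-A ((Ā ^M a) ▷ ((A ^M a) ▷ v)) ⟩
    (Ā ^M a) ▷ ((A ^M a) ▷ v)                ≈⟨ Āᵃ-Aᵃ a v ⟩
    v                                        ∎
    where open ~-Reasoning

  Āᵃ-down : ∀ a b v → (Ā ^M a) ▷ v ~ (Ā ^M (a ℕ.+ b)) ▷ ((A ^M b) ▷ v)
  Āᵃ-down a b v = begin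
    (Ā ^M a) ▷ v                              ≈⟨ ~-pow Ā ~-Ā a (Āᵃ-Aᵃ b v) ⟨
    (Ā ^M a) ▷ ((Ā ^M b) ▷ ((A ^M b) ▷ v))    ≈⟨ ~-≗ (pow-+ Ā a b ((A ^M b) ▷ v)) ⟨
    (Ā ^M (a ℕ.+ b)) ▷ ((A ^M b) ▷ v)         ∎
    where open ~-Reasoning

  low : DL n → Vecℤ n
  low (v , i) = (Ā ^M i) ▷ v

  low-≈ : ∀ x y → x ≈[ A ] y → low x ~ low y
  low-≈ (v , i) (w , j) (k , e) = begin
    (Ā ^M i) ▷ v                                        ≈⟨ Āᵃ-down i (j ℕ.+ k) v ⟩
    (Ā ^M (i ℕ.+ (j ℕ.+ k))) ▷ ((A ^M (j ℕ.+ k)) ▷ v)   ≈⟨ ~-≗ (▷-cong (Ā ^M (i ℕ.+ (j ℕ.+ k))) e) ⟩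
    (Ā ^M (i ℕ.+ (j ℕ.+ k))) ▷ ((A ^M (i ℕ.+ k)) ▷ w)   ≈⟨ ~-≗ (pow-≡ Ā _ (exchange i j k)) ⟩
    (Ā ^M (j ℕ.+ (i ℕ.+ k))) ▷ ((A ^M (i ℕ.+ k)) ▷ w)   ≈⟨ Āᵃ-down j (i ℕ.+ k) w ⟨
    (Ā ^M j) ▷ w                                        ∎
    where
    open ~-Reasoning
    exchange : ∀ i j k → i ℕ.+ (j ℕ.+ k) ≡ j ℕ.+ (i ℕ.+ k)
    exchange = ℕ-Solver.solve-∀

  low-add : ∀ x y → low (addDL A x y) ~ low x ⊞ low y
  low-add (v , i) (w , j) = begin
    (Ā ^M (i ℕ.+ j)) ▷ (((A ^M j) ▷ v) ⊞ ((A ^M i) ▷ w))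
      ≈⟨ ~-≗ (▷-⊞ (Ā ^M (i ℕ.+ j)) ((A ^M j) ▷ v) ((A ^M i) ▷ w)) ⟩
    ((Ā ^M (i ℕ.+ j)) ▷ ((A ^M j) ▷ v)) ⊞ ((Ā ^M (i ℕ.+ j)) ▷ ((A ^M i) ▷ w))
      ≈⟨ ~-⊞ (~-sym (Āᵃ-down i j v)) (~-≗ (pow-≡ Ā _ (ℕP.+-comm i j))) ⟩
    ((Ā ^M i) ▷ v) ⊞ ((Ā ^M (j ℕ.+ i)) ▷ ((A ^M i) ▷ w))
      ≈⟨ ~-⊞ (~-refl {(Ā ^M i) ▷ v}) (~-sym (Āᵃ-down j i w)) ⟩
    ((Ā ^M i) ▷ v) ⊞ ((Ā ^M j) ▷ w)
      ∎
    where open ~-Reasoning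

  low-shift : ∀ x → low (shift A x) ≗ A ▷ low x
  low-shift (v , i) = pow-comm Ā A Ā-comm i v

module DirectLimit {n : ℕ} (A : Matℤ n) where

  ≈-refl : ∀ x → x ≈[ A ] x
  ≈-refl (v , i) = 0 , λ _ → refl

  ≈-sym : ∀ x y → x ≈[ A ] y → y ≈[ A ] x
  ≈-sym (v , i) (w , j) (k , e) = k , ≗-sym e

  ≈-trans : ∀ x y z → x ≈[ A ] y → y ≈[ A ] z → x ≈[ A ] z
  ≈-trans (v , i) (w , j) (u , l) (k , e₁) (m , e₂) = j ℕ.+ (k ℕ.+ m) , (begin
    (A ^M (l ℕ.+ (j ℕ.+ (k ℕ.+ m)))) ▷ v      ≈⟨ pow-split A v _ (l ℕ.+ m) (j ℕ.+ k) (reorder₁ l j k m) ⟩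
    (A ^M (l ℕ.+ m)) ▷ ((A ^M (j ℕ.+ k)) ▷ v)  ≈⟨ ▷-cong (A ^M (l ℕ.+ m)) e₁ ⟩
    (A ^M (l ℕ.+ m)) ▷ ((A ^M (i ℕ.+ k)) ▷ w)  ≈⟨ pow-regroup A w (l ℕ.+ m) (i ℕ.+ k) (i ℕ.+ k) (l ℕ.+ m) (ℕP.+-comm (l ℕ.+ m) (i ℕ.+ k)) ⟩
    (A ^M (i ℕ.+ k)) ▷ ((A ^M (l ℕ.+ m)) ▷ w)  ≈⟨ ▷-cong (A ^M (i ℕ.+ k)) e₂ ⟩
    (A ^M (i ℕ.+ k)) ▷ ((A ^M (j ℕ.+ m)) ▷ u)  ≈⟨ pow-split A u _ (i ℕ.+ k) (j ℕ.+ m) (reorder₂ i j k m) ⟨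
    (A ^M (i ℕ.+ (j ℕ.+ (k ℕ.+ m)))) ▷ u      ∎)
    where
    open ≗-Reasoning
    reorder₁ : ∀ l j k m → l ℕ.+ (j ℕ.+ (k ℕ.+ m)) ≡ (l ℕ.+ m) ℕ.+ (j ℕ.+ k)
    reorder₁ = ℕ-Solver.solve-∀
    reorder₂ : ∀ i j k m → i ℕ.+ (j ℕ.+ (k ℕ.+ m)) ≡ (i ℕ.+ k) ℕ.+ (j ℕ.+ m)
    reorder₂ = ℕ-Solver.solve-∀

  setoid : Setoid _ _
  setoid = record
    { Carrier       = DL n
    ; _≈_           = _≈[ A ]_
    ; isEquivalence = record
      { refl  = λ {x} → ≈-refl x
      ; sym   = λ {x} {y} → ≈-sym x y
      ; trans = λ {x} {y} {z} → ≈-trans x y z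
      }
    }

  module ≈-Reasoning = SetoidReasoning setoid

  ≈-level : ∀ i {v w} → v ≗ w → (v , i) ≈[ A ] (w , i)
  ≈-level i h = 0 , ▷-cong (A ^M (i ℕ.+ 0)) h

  ≈-lift : ∀ i v → (v , 0) ≈[ A ] ((A ^M i) ▷ v , i)
  ≈-lift i v = 0 , ≗-trans (pow-≡ A v (ℕP.+-identityʳ i)) (≗-sym (idM-▷ ((A ^M i) ▷ v)))

  add-congˡ : ∀ x x' y → x ≈[ A ] x' → addDL A x y ≈[ A ] addDL A x' y
  add-congˡ (v , i) (v' , i') (w , j) (k , e) = k , (begin
    (A ^M ((i' ℕ.+ j) ℕ.+ k)) ▷ (((A ^M j) ▷ v) ⊞ ((A ^M i) ▷ w))
      ≈⟨ ▷-⊞ (A ^M ((i' ℕ.+ j) ℕ.+ k)) ((A ^M j) ▷ v) ((A ^M i) ▷ w) ⟩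
    ((A ^M ((i' ℕ.+ j) ℕ.+ k)) ▷ ((A ^M j) ▷ v)) ⊞ ((A ^M ((i' ℕ.+ j) ℕ.+ k)) ▷ ((A ^M i) ▷ w))
      ≈⟨ ⊞-cong first (pow-regroup A w _ i _ i' (reorder₂ i' j k i)) ⟩
    ((A ^M ((i ℕ.+ j) ℕ.+ k)) ▷ ((A ^M j) ▷ v')) ⊞ ((A ^M ((i ℕ.+ j) ℕ.+ k)) ▷ ((A ^M i') ▷ w))
      ≈⟨ ▷-⊞ (A ^M ((i ℕ.+ j) ℕ.+ k)) ((A ^M j) ▷ v') ((A ^M i') ▷ w) ⟨
    (A ^M ((i ℕ.+ j) ℕ.+ k)) ▷ (((A ^M j) ▷ v') ⊞ ((A ^M i') ▷ w))
      ∎)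
    where
    open ≗-Reasoning
    reorder₁ : ∀ i j k → ((i ℕ.+ j) ℕ.+ k) ℕ.+ j ≡ (j ℕ.+ j) ℕ.+ (i ℕ.+ k)
    reorder₁ = ℕ-Solver.solve-∀
    reorder₂ : ∀ i' j k i → ((i' ℕ.+ j) ℕ.+ k) ℕ.+ i ≡ ((i ℕ.+ j) ℕ.+ k) ℕ.+ i'
    reorder₂ = ℕ-Solver.solve-∀
    first : (A ^M ((i' ℕ.+ j) ℕ.+ k)) ▷ ((A ^M j) ▷ v) ≗ (A ^M ((i ℕ.+ j) ℕ.+ k)) ▷ ((A ^M j) ▷ v')
    first = begin
      (A ^M ((i' ℕ.+ j) ℕ.+ k)) ▷ ((A ^M j) ▷ v)   ≈⟨ pow-regroup A v _ j (j ℕ.+ j) (i' ℕ.+ k) (reorder₁ i' j k) ⟩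
      (A ^M (j ℕ.+ j)) ▷ ((A ^M (i' ℕ.+ k)) ▷ v)   ≈⟨ ▷-cong (A ^M (j ℕ.+ j)) e ⟩
      (A ^M (j ℕ.+ j)) ▷ ((A ^M (i ℕ.+ k)) ▷ v')   ≈⟨ pow-regroup A v' _ j (j ℕ.+ j) (i ℕ.+ k) (reorder₁ i j k) ⟨
      (A ^M ((i ℕ.+ j) ℕ.+ k)) ▷ ((A ^M j) ▷ v')   ∎

  add-comm : ∀ x y → addDL A x y ≈[ A ] addDL A y x
  add-comm (v , i) (w , j) = 0 ,
    ≗-trans (pow-≡ A _ (cong (ℕ._+ 0) (ℕP.+-comm j i)))
            (▷-cong (A ^M ((i ℕ.+ j) ℕ.+ 0)) (λ r → ℤP.+-comm (((A ^M j) ▷ v) r) (((A ^M i) ▷ w) r)))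

  add-cong : ∀ x x' y y' → x ≈[ A ] x' → y ≈[ A ] y' → addDL A x y ≈[ A ] addDL A x' y'
  add-cong x x' y y' h g = begin
    addDL A x y      ≈⟨ add-congˡ x x' y h ⟩
    addDL A x' y     ≈⟨ add-comm x' y ⟩
    addDL A y x'     ≈⟨ add-congˡ y y' x' g ⟩
    addDL A y' x'    ≈⟨ add-comm y' x' ⟩
    addDL A x' y'    ∎
    where open ≈-Reasoning

  shift-cong : ∀ x y → x ≈[ A ] y → shift A x ≈[ A ] shift A y
  shift-cong (v , i) (w , j) (k , e) = k , (begin
    (A ^M (j ℕ.+ k)) ▷ (A ▷ v)     ≈⟨ pow-comm A A (λ _ _ → refl) (j ℕ.+ k) v ⟩
    A ▷ ((A ^M (j ℕ.+ k)) ▷ v)     ≈⟨ ▷-cong A e ⟩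
    A ▷ ((A ^M (i ℕ.+ k)) ▷ w)     ≈⟨ pow-comm A A (λ _ _ → refl) (i ℕ.+ k) w ⟨
    (A ^M (i ℕ.+ k)) ▷ (A ▷ w)     ∎)
    where open ≗-Reasoning

module Intertwining {n n' : ℕ} (A : Matℤ n) (A' : Matℤ n') (p : Poly)
  (f : Vecℤ n' → Vecℤ n)
  (f-cong : ∀ {v w} → v ≗ w → Congruent (evalM p A) (f v) (f w))
  (f-⊞ : ∀ v w → Congruent (evalM p A) (f (v ⊞ w)) (f v ⊞ f w))
  (f-A : ∀ v → Congruent (evalM p A) (f (A' ▷ v)) (A ▷ f v)) where

  open PolyCoker A p
  open ~-Reasoning

  f-0v : f 0v ~ 0v
  f-0v = ~-cancel (begin
    f 0v              ≈⟨ f-cong (λ _ → refl) ⟩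
    f (0v ⊞ 0v)       ≈⟨ f-⊞ 0v 0v ⟩
    f 0v ⊞ f 0v       ∎)

  f-neg : ∀ v → f (-1ℤ ⊙ v) ~ -1ℤ ⊙ f v
  f-neg v = ~-negate (begin
    f v ⊞ f (-1ℤ ⊙ v)     ≈⟨ f-⊞ v (-1ℤ ⊙ v) ⟨
    f (v ⊞ (-1ℤ ⊙ v))     ≈⟨ f-cong (λ i → cancel (v i)) ⟩
    f 0v                  ≈⟨ f-0v ⟩
    0v                    ∎)
    where
    cancel : ∀ a → a + -1ℤ * a ≡ 0ℤ
    cancel = solve-∀

  f-⊙ℕ : ∀ m v → f (ℤ.+ m ⊙ v) ~ ℤ.+ m ⊙ f v
  f-⊙ℕ zero v = begin
    f (ℤ.+ 0 ⊙ v)             ≈⟨ f-cong (λ i → ℤP.*-zeroˡ (v i)) ⟩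
    f 0v                      ≈⟨ f-0v ⟩
    0v                        ≈⟨ ~-≗ (λ i → ℤP.*-zeroˡ (f v i)) ⟨
    ℤ.+ 0 ⊙ f v               ∎
  f-⊙ℕ (suc m) v = begin
    f (ℤ.+ suc m ⊙ v)         ≈⟨ f-cong (λ i → succ (v i) (ℤ.+ m)) ⟩
    f (v ⊞ (ℤ.+ m ⊙ v))       ≈⟨ f-⊞ v (ℤ.+ m ⊙ v) ⟩
    f v ⊞ f (ℤ.+ m ⊙ v)       ≈⟨ ~-⊞ (~-refl {f v}) (f-⊙ℕ m v) ⟩
    f v ⊞ (ℤ.+ m ⊙ f v)       ≈⟨ ~-≗ (λ i → succ (f v i) (ℤ.+ m)) ⟨
    ℤ.+ suc m ⊙ f v           ∎
    where
    succ : ∀ x y → (1ℤ + y) * x ≡ x + y * x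
    succ = solve-∀

  f-⊙ : ∀ d v → f (d ⊙ v) ~ d ⊙ f v
  f-⊙ (ℤ.+ m) v = f-⊙ℕ m v
  f-⊙ -[1+ m ] v = begin
    f (-[1+ m ] ⊙ v)              ≈⟨ f-cong (λ i → negate (ℤ.+ suc m) (v i)) ⟩
    f (-1ℤ ⊙ (ℤ.+ suc m ⊙ v))     ≈⟨ f-neg (ℤ.+ suc m ⊙ v) ⟩
    -1ℤ ⊙ f (ℤ.+ suc m ⊙ v)       ≈⟨ ~-⊙ -1ℤ (f-⊙ℕ (suc m) v) ⟩
    -1ℤ ⊙ (ℤ.+ suc m ⊙ f v)       ≈⟨ ~-≗ (λ i → negate (ℤ.+ suc m) (f v i)) ⟨
    -[1+ m ] ⊙ f v                ∎
    where
    negate : ∀ y x → (- y) * x ≡ -1ℤ * (y * x)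
    negate = solve-∀

  f-evalM : ∀ q v → f (evalM q A' ▷ v) ~ evalM q A ▷ f v
  f-evalM [] v = begin
    f (evalM [] A' ▷ v)     ≈⟨ f-cong (evalM-[] A' v) ⟩
    f 0v                    ≈⟨ f-0v ⟩
    0v                      ≈⟨ ~-≗ (evalM-[] A (f v)) ⟨
    evalM [] A ▷ f v        ∎
  f-evalM (d ∷ q) v = begin
    f (evalM (d ∷ q) A' ▷ v)                  ≈⟨ f-cong (evalM-∷ A' d q v) ⟩
    f ((d ⊙ v) ⊞ (A' ▷ (evalM q A' ▷ v)))     ≈⟨ f-⊞ (d ⊙ v) (A' ▷ (evalM q A' ▷ v)) ⟩
    f (d ⊙ v) ⊞ f (A' ▷ (evalM q A' ▷ v))     ≈⟨ ~-⊞ (f-⊙ d v) (f-A (evalM q A' ▷ v)) ⟩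
    (d ⊙ f v) ⊞ (A ▷ f (evalM q A' ▷ v))      ≈⟨ ~-⊞ (~-refl {d ⊙ f v}) (~-M (f-evalM q v)) ⟩
    (d ⊙ f v) ⊞ (A ▷ (evalM q A ▷ f v))       ≈⟨ ~-≗ (evalM-∷ A d q (f v)) ⟨
    evalM (d ∷ q) A ▷ f v                     ∎

  f-resp : ∀ v w → v ~[ evalM p A' ] w → f v ~ f w
  f-resp v w (u , h) = begin
    f v                                 ≈⟨ f-cong (λ i → trans (split (v i) (w i)) (cong (w i +_) (h i))) ⟩
    f (w ⊞ (evalM p A' ▷ u))            ≈⟨ f-⊞ w (evalM p A' ▷ u) ⟩
    f w ⊞ f (evalM p A' ▷ u)            ≈⟨ ~-⊞ (~-refl {f w}) (f-evalM p u) ⟩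
    f w ⊞ (evalM p A ▷ f u)             ≈⟨ ~-⊞ (~-refl {f w}) (~-image (f u)) ⟩
    f w ⊞ 0v                            ≈⟨ ~-≗ (λ i → ℤP.+-identityʳ (f w i)) ⟩
    f w                                 ∎
    where
    split : ∀ a b → a ≡ b + (a - b)
    split = solve-∀

record IsShiftHom {n n' : ℕ} (A' : Matℤ n') (A : Matℤ n) (Φ : DL n' → DL n) : Set where
  field
    resp       : ∀ x y → x ≈[ A' ] y → Φ x ≈[ A ] Φ y
    additive   : ∀ x y → Φ (addDL A' x y) ≈[ A ] addDL A (Φ x) (Φ y)
    shift-comm : ∀ x → Φ (shift A' x) ≈[ A ] shift A (Φ x)

inverse-isShiftHom : ∀ {n n'} {A : Matℤ n} {A' : Matℤ n'} {θ : DL n' → DL n} →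
  IsShiftHom A' A θ → (∀ x y → θ x ≈[ A ] θ y → x ≈[ A' ] y) →
  (s : DL n → DL n') → (∀ z → θ (s z) ≈[ A ] z) → IsShiftHom A A' s
inverse-isShiftHom {A = A} {A'} {θ} θ-hom θ-reflect s θs = record
  { resp       = λ x y x≈y → θ-reflect (s x) (s y) (begin
      θ (s x)   ≈⟨ θs x ⟩
      x         ≈⟨ x≈y ⟩
      y         ≈⟨ θs y ⟨
      θ (s y)   ∎)
  ; additive   = λ x y → θ-reflect (s (addDL A x y)) (addDL A' (s x) (s y)) (begin
      θ (s (addDL A x y))               ≈⟨ θs (addDL A x y) ⟩
      addDL A x y                       ≈⟨ add-cong x (θ (s x)) y (θ (s y))
                                             (≈-sym (θ (s x)) x (θs x)) (≈-sym (θ (s y)) y (θs y)) ⟩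
      addDL A (θ (s x)) (θ (s y))       ≈⟨ additive (s x) (s y) ⟨
      θ (addDL A' (s x) (s y))          ∎)
  ; shift-comm = λ x → θ-reflect (s (shift A x)) (shift A' (s x)) (begin
      θ (s (shift A x))                 ≈⟨ θs (shift A x) ⟩
      shift A x                         ≈⟨ shift-cong x (θ (s x)) (≈-sym (θ (s x)) x (θs x)) ⟩
      shift A (θ (s x))                 ≈⟨ shift-comm (s x) ⟨
      θ (shift A' (s x))                ∎)
  }
  where
  open IsShiftHom θ-hom
  open DirectLimit A
  open ≈-Reasoning

module Descend {n n' : ℕ} (A : Matℤ n) (A' : Matℤ n') (c : ℤ) (cs : Poly) (c²≡1 : c * c ≡ 1ℤ)
  (Φ : DL n' → DL n) (Φ-hom : IsShiftHom A' A Φ) where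

  open UnitConstant A c cs c²≡1
  open IsShiftHom Φ-hom
  module U' = UnitConstant A' c cs c²≡1
  open ~-Reasoning

  F : Vecℤ n' → Vecℤ n
  F v = low (Φ (v , 0))

  lowΦ-≈ : ∀ x y → x ≈[ A' ] y → low (Φ x) ~ low (Φ y)
  lowΦ-≈ x y x≈y = low-≈ (Φ x) (Φ y) (resp x y x≈y)

  F-cong : ∀ {v w} → v ≗ w → F v ~ F w
  F-cong {v} {w} h = lowΦ-≈ (v , 0) (w , 0) (DirectLimit.≈-level A' 0 h)

  F-⊞ : ∀ v w → F (v ⊞ w) ~ F v ⊞ F w
  F-⊞ v w = begin
    low (Φ (v ⊞ w , 0))                           ≈⟨ lowΦ-≈ (v ⊞ w , 0) (addDL A' (v , 0) (w , 0)) sum-at-0 ⟩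
    low (Φ (addDL A' (v , 0) (w , 0)))            ≈⟨ low-≈ (Φ (addDL A' (v , 0) (w , 0)))
                                                             (addDL A (Φ (v , 0)) (Φ (w , 0)))
                                                             (additive (v , 0) (w , 0)) ⟩
    low (addDL A (Φ (v , 0)) (Φ (w , 0)))         ≈⟨ low-add (Φ (v , 0)) (Φ (w , 0)) ⟩
    F v ⊞ F w                                     ∎
    where
    sum-at-0 : (v ⊞ w , 0) ≈[ A' ] addDL A' (v , 0) (w , 0)
    sum-at-0 = DirectLimit.≈-level A' 0 (⊞-cong (≗-sym (idM-▷ v)) (≗-sym (idM-▷ w)))

  lowΦ-shift : ∀ x → low (Φ (shift A' x)) ~ A ▷ low (Φ x)
  lowΦ-shift x = begin
    low (Φ (shift A' x))      ≈⟨ low-≈ (Φ (shift A' x)) (shift A (Φ x)) (shift-comm x) ⟩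
    low (shift A (Φ x))       ≈⟨ ~-≗ (low-shift (Φ x)) ⟩
    A ▷ low (Φ x)             ∎

  F-A : ∀ v → F (A' ▷ v) ~ A ▷ F v
  F-A v = lowΦ-shift (v , 0)

  open Intertwining A A' (c ∷ cs) F F-cong F-⊞ F-A public using (f-resp)
  open Intertwining A A' (c ∷ cs) F F-cong F-⊞ F-A using (f-⊙; f-evalM)

  F-Ā : ∀ v → F (U'.Ā ▷ v) ~ Ā ▷ F v
  F-Ā v = begin
    F (U'.Ā ▷ v)                         ≈⟨ F-cong (U'.Ā-▷ v) ⟩
    F ((- c) ⊙ (evalM cs A' ▷ v))        ≈⟨ f-⊙ (- c) (evalM cs A' ▷ v) ⟩
    (- c) ⊙ F (evalM cs A' ▷ v)          ≈⟨ ~-⊙ (- c) (f-evalM cs v) ⟩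
    (- c) ⊙ (evalM cs A ▷ F v)           ≈⟨ ~-≗ (Ā-▷ (F v)) ⟨
    Ā ▷ F v                              ∎

  F-Āpow : ∀ a v → F ((U'.Ā ^M a) ▷ v) ~ (Ā ^M a) ▷ F v
  F-Āpow zero v = begin
    F (idM ▷ v)                          ≈⟨ F-cong (idM-▷ v) ⟩
    F v                                  ≈⟨ ~-≗ (idM-▷ (F v)) ⟨
    idM ▷ F v                            ∎
  F-Āpow (suc a) v = begin
    F ((U'.Ā · (U'.Ā ^M a)) ▷ v)         ≈⟨ F-cong (▷-· U'.Ā (U'.Ā ^M a) v) ⟩
    F (U'.Ā ▷ ((U'.Ā ^M a) ▷ v))         ≈⟨ F-Ā ((U'.Ā ^M a) ▷ v) ⟩
    Ā ▷ F ((U'.Ā ^M a) ▷ v)              ≈⟨ ~-Ā (F-Āpow a v) ⟩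
    Ā ▷ ((Ā ^M a) ▷ F v)                 ≈⟨ ~-≗ (▷-· Ā (Ā ^M a) (F v)) ⟨
    (Ā · (Ā ^M a)) ▷ F v                 ∎

  lowΦ-pow : ∀ m v i → low (Φ ((A' ^M m) ▷ v , i)) ~ (A ^M m) ▷ low (Φ (v , i))
  lowΦ-pow zero v i = begin
    low (Φ (idM ▷ v , i))                ≈⟨ lowΦ-≈ _ _ (DirectLimit.≈-level A' i (idM-▷ v)) ⟩
    low (Φ (v , i))                      ≈⟨ ~-≗ (idM-▷ (low (Φ (v , i)))) ⟨
    idM ▷ low (Φ (v , i))                ∎
  lowΦ-pow (suc m) v i = begin
    low (Φ ((A' · (A' ^M m)) ▷ v , i))       ≈⟨ lowΦ-≈ _ _ (DirectLimit.≈-level A' i (▷-· A' (A' ^M m) v)) ⟩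
    low (Φ (shift A' ((A' ^M m) ▷ v , i)))   ≈⟨ lowΦ-shift ((A' ^M m) ▷ v , i) ⟩
    A ▷ low (Φ ((A' ^M m) ▷ v , i))          ≈⟨ ~-M (lowΦ-pow m v i) ⟩
    A ▷ ((A ^M m) ▷ low (Φ (v , i)))         ≈⟨ ~-≗ (▷-· A (A ^M m) (low (Φ (v , i)))) ⟨
    (A · (A ^M m)) ▷ low (Φ (v , i))         ∎

  F-low : ∀ x → F (U'.low x) ~ low (Φ x)
  F-low (w , i) = begin
    F ((U'.Ā ^M i) ▷ w)                                  ≈⟨ F-Āpow i w ⟩
    (Ā ^M i) ▷ F w                                       ≈⟨ ~-pow Ā ~-Ā i (lowΦ-≈ _ _ (DirectLimit.≈-lift A' i w)) ⟩
    (Ā ^M i) ▷ low (Φ ((A' ^M i) ▷ w , i))               ≈⟨ ~-pow Ā ~-Ā i (lowΦ-pow i w i) ⟩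
    (Ā ^M i) ▷ ((A ^M i) ▷ low (Φ (w , i)))              ≈⟨ Āᵃ-Aᵃ i (low (Φ (w , i))) ⟩
    low (Φ (w , i))                                      ∎

cokerIso-from-inverses : ∀ {n n'} {P : Matℤ n} {P' : Matℤ n'}
  (f : Vecℤ n → Vecℤ n') (g : Vecℤ n' → Vecℤ n) →
  (∀ v w → v ~[ P ] w → Congruent P' (f v) (f w)) →
  (∀ v w → Congruent P' (f (v ⊞ w)) (f v ⊞ f w)) →
  (∀ v w → v ~[ P' ] w → Congruent P (g v) (g w)) →
  (∀ v → Congruent P (g (f v)) v) →
  (∀ y → Congruent P' (f (g y)) y) →
  CokerIso P P'
cokerIso-from-inverses {P = P} {P'} f g f-resp f-⊞ g-resp g∘f f∘g =
  f , (λ v w h → inImage (f-resp v w h)) , (λ v w → inImage (f-⊞ v w)) , f-injective ,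
  λ y → g y , inImage (f∘g y)
  where
  open Coker P
  open ~-Reasoning
  f-injective : ∀ v w → f v ~[ P' ] f w → v ~[ P ] w
  f-injective v w h = inImage (begin
    v              ≈⟨ g∘f v ⟨
    g (f v)        ≈⟨ g-resp (f v) (f w) h ⟩
    g (f w)        ≈⟨ g∘f w ⟩
    w              ∎)

-- Main result: a strong stable isomorphism G_A' ≅ G_A induces an isomorphism
-- ℤⁿ/p(A)ℤⁿ ≅ ℤⁿ'/p(A')ℤⁿ' whenever p(0) is a unit.
stronglyStablyIso⇒cokerIso : ∀ {n n'} (A : Matℤ n) (A' : Matℤ n') c cs → c * c ≡ 1ℤ →
  StronglyStablyIso A A' → CokerIso (evalM (c ∷ cs) A) (evalM (c ∷ cs) A')
stronglyStablyIso⇒cokerIso {n} {n'} A A' c cs c²≡1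
  (θ , θ-resp , θ-additive , θ-reflect , θ-onto , _ , _ , θ-shift) =
  cokerIso-from-inverses Inv.F Fwd.F Inv.f-resp Inv.F-⊞ Fwd.f-resp Fwd∘Inv Inv∘Fwd
  where
  θ-hom : IsShiftHom A' A θ
  θ-hom = record
    { resp = θ-resp ; additive = θ-additive ; shift-comm = λ x → DirectLimit.≈-sym A (shift A (θ x)) (θ (shift A' x)) (θ-shift x) }

  θ⁻¹ : DL n → DL n'
  θ⁻¹ z = proj₁ (θ-onto z)

  θθ⁻¹ : ∀ z → θ (θ⁻¹ z) ≈[ A ] z
  θθ⁻¹ z = proj₂ (θ-onto z)

  module Fwd = Descend A A' c cs c²≡1 θ θ-hom
  module Inv = Descend A' A c cs c²≡1 θ⁻¹ (inverse-isShiftHom θ-hom θ-reflect θ⁻¹ θθ⁻¹)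
  module U = UnitConstant A c cs c²≡1
  module U' = UnitConstant A' c cs c²≡1

  Fwd∘Inv : ∀ v → Fwd.F (Inv.F v) U.~ v
  Fwd∘Inv v = begin
    Fwd.F (Inv.F v)          ≈⟨ Fwd.F-low (θ⁻¹ (v , 0)) ⟩
    U.low (θ (θ⁻¹ (v , 0)))  ≈⟨ U.low-≈ (θ (θ⁻¹ (v , 0))) (v , 0) (θθ⁻¹ (v , 0)) ⟩
    U.low (v , 0)            ≈⟨ U.~-≗ (idM-▷ v) ⟩
    v                        ∎
    where open U.~-Reasoning

  Inv∘Fwd : ∀ y → Inv.F (Fwd.F y) U'.~ y
  Inv∘Fwd y = begin
    Inv.F (Fwd.F y)            ≈⟨ Inv.F-low (θ (y , 0)) ⟩
    U'.low (θ⁻¹ (θ (y , 0)))   ≈⟨ U'.low-≈ (θ⁻¹ (θ (y , 0))) (y , 0)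
                                    (θ-reflect _ _ (θθ⁻¹ (θ (y , 0)))) ⟩
    U'.low (y , 0)             ≈⟨ U'.~-≗ (idM-▷ y) ⟩
    y                          ∎
    where open U'.~-Reasoning

unit-square : ∀ {c} → c ≡ 1ℤ ⊎ c ≡ -1ℤ → c * c ≡ 1ℤ
unit-square (inj₁ refl) = refl
unit-square (inj₂ refl) = refl

-- Ab_p(G_A) = ℤⁿ/p(A)ℤⁿ is an invariant of strong stable isomorphism.
theorem1 : {n n' : ℕ} (A : Matℕ n) (A' : Matℕ n') (p : Poly) →
    Unimodular (toℤ A) → Unimodular (toℤ A') →
    Primitive (toℤ A) → Primitive (toℤ A') →
    (const p ≡ 1ℤ ⊎ const p ≡ -1ℤ) →
    StronglyStablyIso (toℤ A) (toℤ A') →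
    CokerIso (evalM p (toℤ A)) (evalM p (toℤ A'))
theorem1 A A' []       _ _ _ _ (inj₁ ()) _
theorem1 A A' []       _ _ _ _ (inj₂ ()) _
theorem1 A A' (c ∷ cs) _ _ _ _ unit iso =
  stronglyStablyIso⇒cokerIso (toℤ A) (toℤ A') c cs (unit-square unit) iso
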